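{- Let $\langle \mathbf{A},m\rangle$ be a monotonic distributive semilattice. Then the structure $\langle \mathrm{Up}(X(\mathbf{A})),\cap,m_{R_m},X(\mathbf{A})\rangle$ is a monotonic distributive semilattice, and the map $\beta\colon A\to \mathrm{Up}(X(\mathbf{A}))$, $\beta(a)=\{P\in X(\mathbf{A}): a\in P\}$, is an injective homomorphism of monotonic distributive semilattices.
   Context: A semilattice is an algebra $\langle A,\wedge,1\rangle$ with $\wedge$ idempotent, commutative, associative and $a\wedge 1=a$; its natural order is $a\le b$ iff $a\wedge b=a$. A filter is an upset containing $1$ and closed under $\wedge$. A filter $F$ is irreducible if it is proper and whenever $F=F_1\cap F_2$ for filters $F_1,F_2$ then $F=F_1$ or $F=F_2$. An order ideal is a downset $I$ such that for all $a,b\in I$ there is $c\in I$ with $a,b\le c$. A semilattice is distributive if whenever $a\wedge b\le c$ there exist $a_1\ge a$, $b_1\ge b$ with $c=a_1\wedge b_1$. $X(\mathbf{A})$ is the set of irreducible filters of $\mathbf{A}$, $\beta(a)=\{P\in X(\mathbf{A}):a\in P\}$, and $\mathcal{T}_{\mathbf{A}}$ is the topology on $X(\mathbf{A})$ generated by the basis $\{X(\mathbf{A})-\beta(a):a\in A\}$. For a topological space $X$: $\mathcal{KO}(X)$ is the set of compact open subsets; a set $Z\subseteq X$ belongs to $\mathcal{S}(X)$ if $Z=\bigcap\mathcal{L}$ for some family $\mathcal{L}\subseteq\mathcal{KO}(X)$ that is dually directed (for $U,V\in\mathcal{L}$ there is $W\in\mathcal{L}$ with $W\subseteq U\cap V$).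 $\mathrm{Up}(X(\mathbf{A}))$ is the set of subsets of $X(\mathbf{A})$ that are upward closed under inclusion of filters. A monotonic distributive semilattice is a pair $\langle\mathbf{A},m\rangle$ with $\mathbf{A}$ a distributive semilattice and $m\colon A\to A$ satisfying $a\le b\Rightarrow ma\le mb$; a homomorphism of monotonic distributive semilattices is a map preserving $\wedge$, $1$ and commuting with $m$. For $P\in X(\mathbf{A})$ let $m^{ -1}(P)=\{a\in A: ma\in P\}$; for $Z\in\mathcal{S}(X(\mathbf{A}))$ let $I_{\mathbf{A}}(Z)=\{a\in A:\beta(a)\cap Z=\emptyset\}$. The multirelation $R_m\subseteq X(\mathbf{A})\times \mathcal{S}(X(\mathbf{A}))$ is defined by $(P,Z)\in R_m$ iff $m^{ -1}(P)\cap I_{\mathbf{A}}(Z)=\emptyset$, and for $U\subseteq X(\mathbf{A})$, $m_{R_m}(U)=\{P\in X(\mathbf{A}): \forall Z\ ((P,Z)\in R_m\Rightarrow Z\cap U\neq\emptyset)\}$. -}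

module Defs where

open import Level using (Level; _⊔_; 0ℓ; Lift; lift; lower; Setω) renaming (suc to lsuc)
open import Data.Product using (Σ; ∃; ∃₂; _×_; _,_; proj₁; proj₂)
open import Data.Sum using (_⊎_)
open import Data.Unit using (⊤; tt)
open import Data.Empty using (⊥)
open import Data.List using (List)
open import Data.List.Relation.Unary.All using (All)
open import Data.List.Relation.Unary.Any using (Any)
open import Relation.Nullary using (¬_)
open import Relation.Unary using (Pred; _⊆_; _≐_; _∩_)
open import Relation.Binary using (Rel; Poset)
open import Algebra.Core using (Op₁; Op₂)
open import Algebra.Definitions using (Congruent₁)
open import Algebra.Structures using (IsIdempotentCommutativeMonoid)
open import Algebra.Bundles using (RawMonoid)

-- Classical ambient logic (the paper works in ZFC)

LEM : Setω
LEM = ∀ {ℓ} (P : Set ℓ) → P ⊎ ¬ P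

Zorn : Setω
Zorn = ∀ {c ℓ₁ ℓ₂ ℓ₃} (P : Poset c ℓ₁ ℓ₂) →
  let open Poset P in
  (∀ (C : Pred Carrier ℓ₃) →
     (∀ x y → C x → C y → (x ≤ y) ⊎ (y ≤ x)) →
     ∃ λ u → ∀ x → C x → x ≤ u) →
  ∃ λ mx → ∀ x → mx ≤ x → mx ≈ x

module _ {c ℓ} {C : Set c} (_≈_ : Rel C ℓ) (_∧_ : Op₂ C) where

  NatOrder : Rel C ℓ
  NatOrder a b = (a ∧ b) ≈ a

  IsDistributiveSL : Set (c ⊔ ℓ)
  IsDistributiveSL = ∀ a b d → NatOrder (a ∧ b) d →
    ∃₂ λ a₁ b₁ → NatOrder a a₁ × NatOrder b b₁ × (d ≈ (a₁ ∧ b₁))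

record IsMonotonicDistributiveSemilattice {c ℓ} {C : Set c}
    (_≈_ : Rel C ℓ) (_∧_ : Op₂ C) (𝟙 : C) (m : Op₁ C) : Set (c ⊔ ℓ) where
  field
    isIdempotentCommutativeMonoid : IsIdempotentCommutativeMonoid _≈_ _∧_ 𝟙
    distributive : IsDistributiveSL _≈_ _∧_
    m-cong       : Congruent₁ _≈_ m
    m-mono       : ∀ a b → NatOrder _≈_ _∧_ a b → NatOrder _≈_ _∧_ (m a) (m b)

record MonotonicDistributiveSemilattice : Set₁ where
  infixr 7 _∧_
  infix 4 _≈_
  field
    Carrier : Set
    _≈_     : Rel Carrier 0ℓ
    _∧_     : Op₂ Carrier
    𝟙       : Carrier
    m       : Op₁ Carrier
    isMDS   : IsMonotonicDistributiveSemilattice _≈_ _∧_ 𝟙 m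

  _≤_ : Rel Carrier 0ℓ
  _≤_ = NatOrder _≈_ _∧_

  rawMonoid : RawMonoid 0ℓ 0ℓ
  rawMonoid = record { Carrier = Carrier ; _≈_ = _≈_ ; _∙_ = _∧_ ; ε = 𝟙 }

module Dual (𝔸 : MonotonicDistributiveSemilattice) where
  open MonotonicDistributiveSemilattice 𝔸

  record IsFilter (F : Pred Carrier 0ℓ) : Set where
    field
      upset  : ∀ {a b} → a ≤ b → F a → F b
      has-𝟙  : F 𝟙
      ∧-closed : ∀ {a b} → F a → F b → F (a ∧ b)

  IsProper : Pred Carrier 0ℓ → Set
  IsProper F = ∃ λ a → ¬ F a

  IsIrreducible : Pred Carrier 0ℓ → Set₁
  IsIrreducible F = IsFilter F × IsProper F ×
    (∀ (F₁ F₂ : Pred Carrier 0ℓ) → IsFilter F₁ → IsFilter F₂ →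
       F ≐ (F₁ ∩ F₂) → (F ≐ F₁) ⊎ (F ≐ F₂))

  X : Set₁
  X = Σ (Pred Carrier 0ℓ) IsIrreducible

  _∋_ : X → Carrier → Set
  P ∋ a = proj₁ P a

  βset : Carrier → Pred X 0ℓ
  βset a P = P ∋ a

  -- the topology generated by {X − β(a) : a ∈ A}: U is open iff every
  -- point of U has a neighbourhood ⋂_{a ∈ as} (X − β(a)) ⊆ U (as finite)
  IsOpen : Pred X 0ℓ → Set₁
  IsOpen U = ∀ P → U P → ∃ λ (as : List Carrier) →
    All (λ a → ¬ (P ∋ a)) as × (∀ Q → All (λ a → ¬ (Q ∋ a)) as → U Q)

  IsCompact : Pred X 0ℓ → Set₂
  IsCompact K = ∀ (I : Set₁) (V : I → Pred X 0ℓ) → (∀ i → IsOpen (V i)) →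
    (∀ P → K P → ∃ λ i → V i P) →
    ∃ λ (is : List I) → ∀ P → K P → Any (λ i → V i P) is

  IsCompactOpen : Pred X 0ℓ → Set₂
  IsCompactOpen U = IsOpen U × IsCompact U

  InS : Pred X 0ℓ → Set₂
  InS Z = ∃ λ (L : Pred (Pred X 0ℓ) 0ℓ) →
    (∀ U → L U → IsCompactOpen U) ×
    (∀ U V → L U → L V → ∃ λ W → L W × (W ⊆ (U ∩ V))) ×
    (Z ≐ (λ P → ∀ U → L U → U P))

  m⁻¹ : X → Pred Carrier 0ℓ
  m⁻¹ P a = P ∋ m a

  I-of : Pred X 0ℓ → Pred Carrier (lsuc 0ℓ)
  I-of Z a = ∀ Q → Z Q → ¬ (Q ∋ a)

  R : X → Pred X 0ℓ → Set₁
  R P Z = ∀ a → m⁻¹ P a → I-of Z a → ⊥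

  ℓU : Level
  ℓU = lsuc (lsuc 0ℓ)

  IsUp : Pred X ℓU → Set₂
  IsUp U = ∀ P Q → proj₁ P ⊆ proj₁ Q → U P → U Q

  mR : Pred X ℓU → Pred X ℓU
  mR U P = ∀ (Z : Pred X 0ℓ) → InS Z → R P Z → ∃ λ Q → Z Q × U Q

  Up : Set₃
  Up = Σ (Pred X ℓU) IsUp

  _≈ᵤ_ : Rel Up ℓU
  u ≈ᵤ v = proj₁ u ≐ proj₁ v

  _∩ᵤ_ : Op₂ Up
  (U , uU) ∩ᵤ (V , uV) =
    (U ∩ V) , λ P Q P⊆Q UVP → uU P Q P⊆Q (proj₁ UVP) , uV P Q P⊆Q (proj₂ UVP)

  Xᵤ : Up
  Xᵤ = (λ _ → Lift ℓU ⊤) , λ _ _ _ _ → lift tt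

  mᵤ : (∀ U → IsUp U → IsUp (mR U)) → Op₁ Up
  mᵤ cl (U , uU) = mR U , cl U uU

  rawMonoidUp : RawMonoid (lsuc ℓU) ℓU
  rawMonoidUp = record { Carrier = Up ; _≈_ = _≈ᵤ_ ; _∙_ = _∩ᵤ_ ; ε = Xᵤ }

  β : Carrier → Up
  β a = (λ P → Lift ℓU (P ∋ a)) , λ P Q P⊆Q aP → lift (P⊆Q (lower aP))

-- Up(X(A)) is closed under ∩ and ∪, which makes it a distributive semilattice; m_{R_m} is
-- monotone since R_m does not involve U, and maps into upsets since R_m(P, Z) is antitone in P. β is a homomorphism because irreducible
-- filters are filters, and it is injective because a filter maximal among those avoiding a
-- (Zorn) is irreducible. For β(m a) ⊇ m_{R_m}(β a) one tests Z = X − β(a): I(Z) = ↓a, so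
-- (P, Z) ∈ R_m as soon as m a ∉ P, and then Z must meet β(a). That Z ∈ 𝒮(X) rests on the
-- compactness of X − β(a), an Alexander-subbase argument: if an open cover had no finite
-- subcover, a maximal filter F such that no finitely many members of the cover together with
-- one X − β(c), c ∈ F, cover X − β(a) would avoid a and so lie inside an irreducible P ∌ a;
-- but maximality forces every point of X − β(a), P included, to miss some b ∈ F.
module Submission where

open import Defs
open import Data.Product using (Σ-syntax; _×_; Σ; ∃; ∃₂; _,_; proj₁; proj₂)
open import Algebra.Morphism.Structures using (module MonoidMorphisms)
open import Level using (0ℓ; _⊔_; Lift; lift; lower) renaming (suc to lsuc)
open import Data.Empty using (⊥-elim)
open import Data.Sum as Sum using (_⊎_; inj₁; inj₂; [_,_]′)
open import Data.List using (List; []; _∷_; _++_)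
open import Data.List.Relation.Unary.All as All using (All; []; _∷_)
open import Data.List.Relation.Unary.Any using (Any; here; there)
open import Data.List.Relation.Unary.Any.Properties using (++⁺ˡ; ++⁺ʳ)
open import Function using (_∘_)
open import Relation.Nullary using (¬_; Dec; yes; no)
open import Relation.Nullary.Decidable using (True; toWitness; fromWitness; decidable-stable)
open import Relation.Unary using (Pred; _⊆_; _≐_; _∩_; _∪_; ∁; ⋃; ∅)
open import Relation.Unary.Properties using (⊆-trans; ≐-refl; ≐-sym; ≐-trans)
open import Relation.Unary.Algebra using (∩-monoid; ∩-isCommutativeMonoid; ∩-isMagma; ∩-idem)
open import Relation.Binary using (Poset)
open import Relation.Binary.PropositionalEquality using (_≡_; refl)
open import Algebra.Bundles using (Monoid)
open import Algebra.Structures using (module IsIdempotentCommutativeMonoid)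
import Algebra.Morphism.MonoidMonomorphism as MonoidMonomorphism
import Relation.Binary.Construct.NaturalOrder.Left as LeftNaturalOrder

module Classical (lem : LEM) where

  decide : ∀ {ℓ} (P : Set ℓ) → Dec P
  decide P with lem P
  ... | inj₁ p = yes p
  ... | inj₂ ¬p = no ¬p

  ¬¬-elim : ∀ {ℓ} {P : Set ℓ} → ¬ ¬ P → P
  ¬¬-elim {P = P} = decidable-stable (decide P)

  Resize : ∀ {ℓ} → Set ℓ → Set
  Resize P = True (decide P)

  resize : ∀ {ℓ} {P : Set ℓ} → P → Resize P
  resize {P = P} = fromWitness {a? = decide P}

  unresize : ∀ {ℓ} {P : Set ℓ} → Resize P → P
  unresize {P = P} = toWitness {a? = decide P}

IsChain : ∀ {a j} {A : Set a} {J : Set j} → (J → Pred A 0ℓ) → Set (a ⊔ j)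
IsChain {J = J} T = ∀ (i k : J) → T i ⊆ T k ⊎ T k ⊆ T i

module ZornOnSubsets (lem : LEM) (zorn : Zorn) {A : Set} where
  open Classical lem

  -- S₀ ∪ ⋃ T lives in a higher universe, so closure is asked of every level-0 copy U of it
  ChainClosedAbove : ∀ {g} → Pred A 0ℓ → (Pred A 0ℓ → Set g) → Set (lsuc (lsuc 0ℓ ⊔ g))
  ChainClosedAbove {g} S₀ G = ∀ {J : Set (lsuc 0ℓ ⊔ g)} (T : J → Pred A 0ℓ) → IsChain T →
    (∀ j → S₀ ⊆ T j) → (∀ j → G (T j)) → ∀ U → U ≐ S₀ ∪ ⋃ J T → G U

  Maximal : ∀ {g} → (Pred A 0ℓ → Set g) → Pred A 0ℓ → Set (lsuc 0ℓ ⊔ g)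
  Maximal G S = G S × (∀ T → G T → S ⊆ T → T ⊆ S)

  maximal-above : ∀ {g} {S₀ : Pred A 0ℓ} {G : Pred A 0ℓ → Set g} →
    ChainClosedAbove S₀ G → ∃ λ S → S₀ ⊆ S × Maximal G S
  maximal-above {g} {S₀} {G} closed =
    let ((S , S₀⊆S , GS) , maximality) = zorn {ℓ₃ = 0ℓ} ⊆-poset chain-bounded
    in S , S₀⊆S , GS ,
       λ T GT S⊆T → proj₂ (maximality (T , (λ x∈S₀ → S⊆T (S₀⊆S x∈S₀)) , GT) S⊆T)
    where
    Above : Set (lsuc 0ℓ ⊔ g)
    Above = Σ (Pred A 0ℓ) λ S → S₀ ⊆ S × G S

    ⊆-poset : Poset (lsuc 0ℓ ⊔ g) 0ℓ 0ℓ
    ⊆-poset = record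
      { Carrier = Above
      ; _≈_ = λ S T → proj₁ S ≐ proj₁ T
      ; _≤_ = λ S T → proj₁ S ⊆ proj₁ T
      ; isPartialOrder = record
        { isPreorder = record
          { isEquivalence = record { refl = ≐-refl ; sym = ≐-sym ; trans = ≐-trans }
          ; reflexive = proj₁
          ; trans = ⊆-trans }
        ; antisym = _,_ } }

    chain-bounded : (C : Pred Above 0ℓ) →
      (∀ S T → C S → C T → proj₁ S ⊆ proj₁ T ⊎ proj₁ T ⊆ proj₁ S) →
      ∃ λ (B : Above) → ∀ S → C S → proj₁ S ⊆ proj₁ B
    chain-bounded C chain = (U , resize ∘ inj₁ , GU) , λ S CS TS → resize (inj₂ ((S , CS) , TS))
      where
      T : Σ Above C → Pred A 0ℓ
      T = proj₁ ∘ proj₁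
      U : Pred A 0ℓ
      U x = Resize ((S₀ ∪ ⋃ _ T) x)
      GU : G U
      GU = closed T (λ (S , CS) (S′ , CS′) → chain S S′ CS CS′)
             (proj₁ ∘ proj₂ ∘ proj₁) (proj₂ ∘ proj₂ ∘ proj₁) U (unresize , resize)

module FilterTheory (𝔸 : MonotonicDistributiveSemilattice) where
  open MonotonicDistributiveSemilattice 𝔸
  open IsMonotonicDistributiveSemilattice isMDS
  open IsIdempotentCommutativeMonoid isIdempotentCommutativeMonoid
  open Dual 𝔸
  open LeftNaturalOrder _≈_ _∧_ using (x∙y≤x; x∙y≤y; ∙-presʳ-≤) renaming
    (trans to ≼-trans; reflexive to ≼-reflexive; antisym to ≼-antisym)

  -- the library's left natural order is x ≈ x ∧ y, the symmetric form of ours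
  x∧y≤x : ∀ x y → (x ∧ y) ≤ x
  x∧y≤x x y = sym (x∙y≤x isCommutativeBand x y)

  x∧y≤y : ∀ x y → (x ∧ y) ≤ y
  x∧y≤y x y = sym (x∙y≤y isCommutativeBand x y)

  ∧-greatest : ∀ {x y z} → z ≤ x → z ≤ y → z ≤ (x ∧ y)
  ∧-greatest {z = z} z≤x z≤y = sym (∙-presʳ-≤ isCommutativeBand z (sym z≤x) (sym z≤y))

  ≤-trans : ∀ {x y z} → x ≤ y → y ≤ z → x ≤ z
  ≤-trans x≤y y≤z = sym (≼-trans isSemigroup (sym x≤y) (sym y≤z))

  ≤-refl : ∀ x → x ≤ x
  ≤-refl = idem

  ≤-reflexive : ∀ {x y} → x ≈ y → x ≤ y
  ≤-reflexive x≈y = sym (≼-reflexive isMagma idem x≈y)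

  ≤-antisym : ∀ {x y} → x ≤ y → y ≤ x → x ≈ y
  ≤-antisym x≤y y≤x = ≼-antisym isEquivalence comm (sym x≤y) (sym y≤x)

  ≤-𝟙 : ∀ x → x ≤ 𝟙
  ≤-𝟙 = identityʳ

  ∧-monoˡ-≤ : ∀ {x y} z → x ≤ y → (x ∧ z) ≤ (y ∧ z)
  ∧-monoˡ-≤ {x} z x≤y = ∧-greatest (≤-trans (x∧y≤x x z) x≤y) (x∧y≤y x z)

  ↑_ : Carrier → Pred Carrier 0ℓ
  ↑ a = a ≤_

  ↑-isFilter : ∀ a → IsFilter (↑ a)
  ↑-isFilter a = record
    { upset = λ x≤y a≤x → ≤-trans a≤x x≤y ; has-𝟙 = ≤-𝟙 a ; ∧-closed = ∧-greatest }

  adjoin : Pred Carrier 0ℓ → Carrier → Pred Carrier 0ℓ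
  adjoin F b x = ∃ λ c → F c × (c ∧ b) ≤ x

  adjoin-isFilter : ∀ {F} → IsFilter F → ∀ b → IsFilter (adjoin F b)
  adjoin-isFilter isF b = record
    { upset = λ x≤y (c , Fc , c∧b≤x) → c , Fc , ≤-trans c∧b≤x x≤y
    ; has-𝟙 = 𝟙 , IsFilter.has-𝟙 isF , ≤-𝟙 (𝟙 ∧ b)
    ; ∧-closed = λ (c , Fc , c∧b≤x) (d , Fd , d∧b≤y) →
        c ∧ d , IsFilter.∧-closed isF Fc Fd ,
        ∧-greatest (≤-trans (∧-monoˡ-≤ b (x∧y≤x c d)) c∧b≤x)
                   (≤-trans (∧-monoˡ-≤ b (x∧y≤y c d)) d∧b≤y) }

  ⊆-adjoin : ∀ {F} b → F ⊆ adjoin F b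
  ⊆-adjoin b {c} Fc = c , Fc , x∧y≤x c b

  ∈-adjoin : ∀ {F} → IsFilter F → ∀ b → adjoin F b b
  ∈-adjoin isF b = 𝟙 , IsFilter.has-𝟙 isF , x∧y≤y 𝟙 b

  ⋃-chain-isFilter : ∀ {j} {J : Set j} {F U : Pred Carrier 0ℓ} (T : J → Pred Carrier 0ℓ) →
    IsChain T → (∀ j → F ⊆ T j) → IsFilter F → (∀ j → IsFilter (T j)) →
    U ≐ F ∪ ⋃ J T → IsFilter U
  ⋃-chain-isFilter {F = F} {U} T chain F⊆T isF isT (U⊆ , ⊆U) = record
    { upset = λ x≤y Ux → [ ⊆U ∘ inj₁ ∘ IsFilter.upset isF x≤y
                         , (λ (j , Tjx) → ⊆U (inj₂ (j , IsFilter.upset (isT j) x≤y Tjx))) ]′ (U⊆ Ux)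
    ; has-𝟙 = ⊆U (inj₁ (IsFilter.has-𝟙 isF))
    ; ∧-closed = λ Ux Uy → [ (λ (Fx , Fy) → ⊆U (inj₁ (IsFilter.∧-closed isF Fx Fy)))
                           , (λ (j , Tjx , Tjy) → ⊆U (inj₂ (j , IsFilter.∧-closed (isT j) Tjx Tjy))) ]′
                           (in-one-member (U⊆ Ux) (U⊆ Uy)) }
    where
    in-one-member : ∀ {x y} → (F ∪ ⋃ _ T) x → (F ∪ ⋃ _ T) y →
      (F x × F y) ⊎ ∃ λ j → T j x × T j y
    in-one-member (inj₁ Fx) (inj₁ Fy) = inj₁ (Fx , Fy)
    in-one-member (inj₁ Fx) (inj₂ (j , Tjy)) = inj₂ (j , F⊆T j Fx , Tjy)
    in-one-member (inj₂ (j , Tjx)) (inj₁ Fy) = inj₂ (j , Tjx , F⊆T j Fy)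
    in-one-member (inj₂ (j , Tjx)) (inj₂ (k , Tky)) with chain j k
    ... | inj₁ Tj⊆Tk = inj₂ (k , Tj⊆Tk Tjx , Tky)
    ... | inj₂ Tk⊆Tj = inj₂ (j , Tjx , Tk⊆Tj Tky)

  isFilter : (P : X) → IsFilter (proj₁ P)
  isFilter P = proj₁ (proj₂ P)

  β-cong : ∀ {x y} → x ≈ y → β x ≈ᵤ β y
  β-cong x≈y = (λ {P} → lift ∘ IsFilter.upset (isFilter P) (≤-reflexive x≈y) ∘ lower)
             , (λ {P} → lift ∘ IsFilter.upset (isFilter P) (≤-reflexive (sym x≈y)) ∘ lower)

  β-∧ : ∀ x y → β (x ∧ y) ≈ᵤ (β x ∩ᵤ β y)
  β-∧ x y = (λ {P} (lift Pxy) → lift (IsFilter.upset (isFilter P) (x∧y≤x x y) Pxy)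
                              , lift (IsFilter.upset (isFilter P) (x∧y≤y x y) Pxy))
          , (λ {P} (lift Px , lift Py) → lift (IsFilter.∧-closed (isFilter P) Px Py))

  β-𝟙 : β 𝟙 ≈ᵤ Xᵤ
  β-𝟙 = (λ _ → lift _) , (λ {P} _ → lift (IsFilter.has-𝟙 (isFilter P)))

module Upsets (𝔸 : MonotonicDistributiveSemilattice) where
  open Dual 𝔸

  mR-mono : ∀ {U V} → U ⊆ V → mR U ⊆ mR V
  mR-mono U⊆V mRU Z Z∈S RPZ = let (Q , ZQ , UQ) = mRU Z Z∈S RPZ in Q , ZQ , U⊆V UQ

  mR-isUp : ∀ U → IsUp (mR U)
  mR-isUp U P Q P⊆Q mRU Z Z∈S RQZ = mRU Z Z∈S (λ b Pmb → RQZ b (P⊆Q Pmb))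

  mR-preservesUp : ∀ U → IsUp U → IsUp (mR U)
  mR-preservesUp U _ = mR-isUp U

  ⊆⇒≤ᵤ : ∀ u v → proj₁ u ⊆ proj₁ v → NatOrder _≈ᵤ_ _∩ᵤ_ u v
  ⊆⇒≤ᵤ u v u⊆v = proj₁ , λ p → p , u⊆v p

  ≤ᵤ⇒⊆ : ∀ u v → NatOrder _≈ᵤ_ _∩ᵤ_ u v → proj₁ u ⊆ proj₁ v
  ≤ᵤ⇒⊆ u v u≤v = proj₂ ∘ proj₂ u≤v

  proj₁-isMonoidMonomorphism :
    MonoidMorphisms.IsMonoidMonomorphism rawMonoidUp (Monoid.rawMonoid (∩-monoid X ℓU)) proj₁
  proj₁-isMonoidMonomorphism = record
    { isMonoidHomomorphism = record
      { isMagmaHomomorphism = record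
        { isRelHomomorphism = record { cong = λ u≈v → u≈v }
        ; homo = λ _ _ → ≐-refl }
      ; ε-homo = ≐-refl }
    ; injective = λ u≈v → u≈v }

  _∪ᵤ_ : Up → Up → Up
  (U , U-up) ∪ᵤ (V , V-up) =
    U ∪ V , λ P Q P⊆Q → [ inj₁ ∘ U-up P Q P⊆Q , inj₂ ∘ V-up P Q P⊆Q ]′

  -- u ∩ v ≤ w is witnessed by w = (u ∪ w) ∩ (v ∪ w)
  ∩ᵤ-distributive : IsDistributiveSL _≈ᵤ_ _∩ᵤ_
  ∩ᵤ-distributive u v w u∩v≤w =
    u ∪ᵤ w , v ∪ᵤ w , ⊆⇒≤ᵤ u (u ∪ᵤ w) inj₁ , ⊆⇒≤ᵤ v (v ∪ᵤ w) inj₁ ,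
    (λ p → inj₂ p , inj₂ p) , from-∪
    where
    from-∪ : ∀ {P} → (proj₁ u ∪ proj₁ w) P × (proj₁ v ∪ proj₁ w) P → proj₁ w P
    from-∪ (inj₂ wP , _) = wP
    from-∪ (inj₁ _ , inj₂ wP) = wP
    from-∪ (inj₁ uP , inj₁ vP) = ≤ᵤ⇒⊆ (u ∩ᵤ v) w u∩v≤w (uP , vP)

  Up-isMonotonicDistributiveSemilattice :
    IsMonotonicDistributiveSemilattice _≈ᵤ_ _∩ᵤ_ Xᵤ (mᵤ mR-preservesUp)
  Up-isMonotonicDistributiveSemilattice = record
    { isIdempotentCommutativeMonoid = record
      { isCommutativeMonoid = isCommutativeMonoid (∩-isCommutativeMonoid X ℓU)
      ; idem = idem (∩-isMagma X ℓU) ∩-idem }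
    ; distributive = ∩ᵤ-distributive
    ; m-cong = λ (u⊆v , v⊆u) → (λ {P} → mR-mono u⊆v {P}) , (λ {P} → mR-mono v⊆u {P})
    ; m-mono = λ u v u≤v → ⊆⇒≤ᵤ (m′ u) (m′ v) (λ {P} → mR-mono (≤ᵤ⇒⊆ u v u≤v) {P}) }
    where
    open MonoidMonomorphism proj₁-isMonoidMonomorphism
    m′ : Up → Up
    m′ = mᵤ mR-preservesUp

module Representation (lem : LEM) (zorn : Zorn) (𝔸 : MonotonicDistributiveSemilattice) where
  open MonotonicDistributiveSemilattice 𝔸
  open IsMonotonicDistributiveSemilattice isMDS using (m-mono)
  open Dual 𝔸
  open Classical lem
  open ZornOnSubsets lem zorn
  open FilterTheory 𝔸
  open Upsets 𝔸 using (mR-preservesUp)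

  maximal-avoiding⇒isIrreducible : ∀ {P a} → IsFilter P → ¬ P a →
    (∀ F → IsFilter F → ¬ F a → P ⊆ F → F ⊆ P) → IsIrreducible P
  maximal-avoiding⇒isIrreducible {P} {a} isP ¬Pa maximality =
    isP , (a , ¬Pa) , irreducible
    where
    irreducible : ∀ F₁ F₂ → IsFilter F₁ → IsFilter F₂ → P ≐ (F₁ ∩ F₂) → P ≐ F₁ ⊎ P ≐ F₂
    irreducible F₁ F₂ isF₁ isF₂ (P⊆ , ⊆P) with decide (F₁ a) | decide (F₂ a)
    ... | no ¬F₁a | _ = inj₁ (proj₁ ∘ P⊆ , maximality F₁ isF₁ ¬F₁a (proj₁ ∘ P⊆))
    ... | yes _ | no ¬F₂a = inj₂ (proj₂ ∘ P⊆ , maximality F₂ isF₂ ¬F₂a (proj₂ ∘ P⊆))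
    ... | yes F₁a | yes F₂a = ⊥-elim (¬Pa (⊆P (F₁a , F₂a)))

  prime-filter-theorem : ∀ {F a} → IsFilter F → ¬ F a → ∃ λ (P : X) → F ⊆ proj₁ P × ¬ P ∋ a
  prime-filter-theorem {F} {a} isF ¬Fa =
    let (P , F⊆P , (isP , ¬Pa) , maximality) = maximal-above avoiding-chainClosed
    in (P , maximal-avoiding⇒isIrreducible isP ¬Pa (λ T isT ¬Ta → maximality T (isT , ¬Ta)))
     , F⊆P , ¬Pa
    where
    avoiding-chainClosed : ChainClosedAbove F (λ S → IsFilter S × ¬ S a)
    avoiding-chainClosed T chain F⊆T GT U U≐ =
      ⋃-chain-isFilter T chain F⊆T isF (proj₁ ∘ GT) U≐ ,
      [ ¬Fa , (λ (j , Tja) → proj₂ (GT j) Tja) ]′ ∘ proj₁ U≐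

  βset-⊆⇒≤ : ∀ {a b} → βset a ⊆ βset b → a ≤ b
  βset-⊆⇒≤ {a} β⊆ = ¬¬-elim λ a≰b →
    let (P , ↑a⊆P , ¬Pb) = prime-filter-theorem (↑-isFilter a) a≰b
    in ¬Pb (β⊆ {P} (↑a⊆P (≤-refl a)))

  β-injective : ∀ {x y} → β x ≈ᵤ β y → x ≈ y
  β-injective (βx⊆βy , βy⊆βx) =
    ≤-antisym (βset-⊆⇒≤ (λ {P} → lower ∘ βx⊆βy {P} ∘ lift))
              (βset-⊆⇒≤ (λ {P} → lower ∘ βy⊆βx {P} ∘ lift))

  β-isMonoidMonomorphism : MonoidMorphisms.IsMonoidMonomorphism rawMonoid rawMonoidUp β
  β-isMonoidMonomorphism = record
    { isMonoidHomomorphism = record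
      { isMagmaHomomorphism = record
        { isRelHomomorphism = record { cong = β-cong }
        ; homo = β-∧ }
      ; ε-homo = β-𝟙 }
    ; injective = β-injective }

  ∉-∧ : ∀ {F x y} → IsFilter F → ¬ F (x ∧ y) → ¬ F x ⊎ ¬ F y
  ∉-∧ {F} {x} isF ¬Fx∧y with decide (F x)
  ... | yes Fx = inj₂ (¬Fx∧y ∘ IsFilter.∧-closed isF Fx)
  ... | no ¬Fx = inj₁ ¬Fx

  ∁β-isOpen : ∀ a → IsOpen (∁ (βset a))
  ∁β-isOpen a P ¬Pa = a ∷ [] , ¬Pa ∷ [] , λ { Q (¬Qa ∷ []) → ¬Qa }

  module Compactness (a : Carrier) {I : Set₁} (V : I → Pred X 0ℓ)
                     (V-open : ∀ i → IsOpen (V i)) (V-covers : ∀ P → ¬ P ∋ a → ∃ λ i → V i P) where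

    FiniteSubcover : Set₁
    FiniteSubcover = ∃ λ (is : List I) → ∀ P → ¬ P ∋ a → Any (λ i → V i P) is

    -- ∁β(a) ⊆ V i₁ ∪ … ∪ V iₙ ∪ ∁β(c) ∪ E; one c stands for finitely many once F is a filter
    Covers : List I → Carrier → Pred X 0ℓ → Set₁
    Covers is c E = ∀ Q → ¬ Q ∋ a → Any (λ i → V i Q) is ⊎ ¬ Q ∋ c ⊎ E Q

    CoveredUpTo : Pred Carrier 0ℓ → Pred X 0ℓ → Set₁
    CoveredUpTo F E = ∃₂ λ is c → F c × Covers is c E

    coveredUpTo-mono : ∀ {F E E′} → E ⊆ E′ → CoveredUpTo F E → CoveredUpTo F E′
    coveredUpTo-mono E⊆E′ (is , c , Fc , cover) =
      is , c , Fc , λ Q ¬Qa → Sum.map₂ (Sum.map₂ E⊆E′) (cover Q ¬Qa)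

    coveredUpTo-∩ : ∀ {F E₁ E₂} → IsFilter F →
      CoveredUpTo F E₁ → CoveredUpTo F E₂ → CoveredUpTo F (E₁ ∩ E₂)
    coveredUpTo-∩ {E₁ = E₁} {E₂} isF (is₁ , c₁ , Fc₁ , cover₁) (is₂ , c₂ , Fc₂ , cover₂) =
      is₁ ++ is₂ , c₁ ∧ c₂ , IsFilter.∧-closed isF Fc₁ Fc₂ , cover
      where
      cover : Covers (is₁ ++ is₂) (c₁ ∧ c₂) (E₁ ∩ E₂)
      cover Q ¬Qa with cover₁ Q ¬Qa | cover₂ Q ¬Qa
      ... | inj₁ Vis₁ | _ = inj₁ (++⁺ˡ Vis₁)
      ... | inj₂ (inj₁ ¬Qc₁) | _ = inj₂ (inj₁ (¬Qc₁ ∘ IsFilter.upset (isFilter Q) (x∧y≤x c₁ c₂)))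
      ... | inj₂ (inj₂ _) | inj₁ Vis₂ = inj₁ (++⁺ʳ is₁ Vis₂)
      ... | inj₂ (inj₂ _) | inj₂ (inj₁ ¬Qc₂) = inj₂ (inj₁ (¬Qc₂ ∘ IsFilter.upset (isFilter Q) (x∧y≤y c₁ c₂)))
      ... | inj₂ (inj₂ E₁Q) | inj₂ (inj₂ E₂Q) = inj₂ (inj₂ (E₁Q , E₂Q))

    coveredUpTo-All : ∀ {F} → IsFilter F → ∀ bs → All (λ b → CoveredUpTo F (∁ (βset b))) bs →
      CoveredUpTo F (λ Q → All (λ b → ¬ Q ∋ b) bs)
    coveredUpTo-All isF [] [] = [] , 𝟙 , IsFilter.has-𝟙 isF , λ _ _ → inj₂ (inj₂ [])
    coveredUpTo-All isF (b ∷ bs) (covered ∷ covereds) =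
      coveredUpTo-mono (λ (¬Qb , ¬Q∋bs) → ¬Qb ∷ ¬Q∋bs)
        (coveredUpTo-∩ isF covered (coveredUpTo-All isF bs covereds))

    coveredUpTo-absorb : ∀ {F E} i → (∀ Q → ¬ Q ∋ a → E Q → V i Q) →
      CoveredUpTo F E → CoveredUpTo F ∅
    coveredUpTo-absorb i E⊆Vi (is , c , Fc , cover) = i ∷ is , c , Fc , cover′
      where
      cover′ : Covers (i ∷ is) c ∅
      cover′ Q ¬Qa with cover Q ¬Qa
      ... | inj₁ Vis = inj₁ (there Vis)
      ... | inj₂ (inj₁ ¬Qc) = inj₂ (inj₁ ¬Qc)
      ... | inj₂ (inj₂ EQ) = inj₁ (here (E⊆Vi Q ¬Qa EQ))

    coveredUpTo-adjoin : ∀ {F b} → CoveredUpTo (adjoin F b) ∅ → CoveredUpTo F (∁ (βset b))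
    coveredUpTo-adjoin {b = b} (is , c , (d , Fd , d∧b≤c) , cover) = is , d , Fd , cover′
      where
      cover′ : Covers is d (∁ (βset b))
      cover′ Q ¬Qa with cover Q ¬Qa
      ... | inj₁ Vis = inj₁ Vis
      ... | inj₂ (inj₁ ¬Qc) = inj₂ (∉-∧ (isFilter Q) (¬Qc ∘ IsFilter.upset (isFilter Q) d∧b≤c))

    coveredUpTo-↑𝟙 : CoveredUpTo (↑ 𝟙) ∅ → FiniteSubcover
    coveredUpTo-↑𝟙 (is , c , 𝟙≤c , cover) = is , cover′
      where
      cover′ : ∀ Q → ¬ Q ∋ a → Any (λ i → V i Q) is
      cover′ Q ¬Qa with cover Q ¬Qa
      ... | inj₁ Vis = Vis
      ... | inj₂ (inj₁ ¬Qc) = ⊥-elim (¬Qc (IsFilter.upset (isFilter Q) 𝟙≤c (IsFilter.has-𝟙 (isFilter Q))))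

    NonCovering : Pred Carrier 0ℓ → Set₁
    NonCovering F = IsFilter F × ¬ CoveredUpTo F ∅

    nonCovering-chainClosed : ¬ FiniteSubcover → ChainClosedAbove (↑ 𝟙) NonCovering
    nonCovering-chainClosed no-subcover T chain ↑𝟙⊆T nonCoveringT U U≐ =
      ⋃-chain-isFilter T chain ↑𝟙⊆T (↑-isFilter 𝟙) (proj₁ ∘ nonCoveringT) U≐ ,
      λ (is , c , Uc , cover) →
        [ (λ 𝟙≤c → no-subcover (coveredUpTo-↑𝟙 (is , c , 𝟙≤c , cover)))
        , (λ (j , Tjc) → proj₂ (nonCoveringT j) (is , c , Tjc , cover)) ]′ (proj₁ U≐ Uc)

    maximal⇒coveredUpTo-∁β : ∀ {F b} → Maximal NonCovering F → ¬ F b → CoveredUpTo F (∁ (βset b))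
    maximal⇒coveredUpTo-∁β {F} {b} ((isF , _) , maximality) ¬Fb =
      coveredUpTo-adjoin (¬¬-elim λ ¬covered →
        ¬Fb (maximality (adjoin F b) (adjoin-isFilter isF b , ¬covered) (⊆-adjoin b) (∈-adjoin isF b)))

    -- A basic neighbourhood ∁β(b₁) ∩ … ∩ ∁β(bₙ) ⊆ V i of P would otherwise have all bₖ ∉ F,
    -- and the covers of ∁β(a) up to each ∁β(bₖ) combine with V i into a cover.
    maximal-separates : ∀ {F} → Maximal NonCovering F → ∀ P → ¬ P ∋ a → ∃ λ b → F b × ¬ P ∋ b
    maximal-separates {F} F-max@((isF , ¬covered) , _) P ¬Pa = ¬¬-elim λ no-separator →
      let (i , ViP) = V-covers P ¬Pa
          (bs , ¬P∋bs , nbhd⊆Vi) = V-open i P ViP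
          covered-beside : All (λ b → CoveredUpTo F (∁ (βset b))) bs
          covered-beside = All.map (λ {b} ¬Pb →
            maximal⇒coveredUpTo-∁β F-max (λ Fb → no-separator (b , Fb , ¬Pb))) ¬P∋bs
      in ¬covered (coveredUpTo-absorb i (λ Q _ → nbhd⊆Vi Q) (coveredUpTo-All isF bs covered-beside))

    ¬¬finiteSubcover : ¬ ¬ FiniteSubcover
    ¬¬finiteSubcover no-subcover with maximal-above (nonCovering-chainClosed no-subcover)
    ... | F , _ , F-max@((isF , ¬covered) , _) with decide (F a)
    ... | yes Fa = ¬covered ([] , a , Fa , λ _ ¬Qa → inj₂ (inj₁ ¬Qa))
    ... | no ¬Fa =
      let (P , F⊆P , ¬Pa) = prime-filter-theorem isF ¬Fa
          (b , Fb , ¬Pb) = maximal-separates F-max P ¬Pa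
      in ¬Pb (F⊆P Fb)

  ∁β-isCompact : ∀ a → IsCompact (∁ (βset a))
  ∁β-isCompact a I V V-open V-covers =
    ¬¬-elim (Compactness.¬¬finiteSubcover a V V-open V-covers)

  compactOpen⇒InS : ∀ {K} → IsCompactOpen K → InS K
  compactOpen⇒InS {K} K-compactOpen =
    L , L-compactOpen , L-directed , (λ {P} → K⊆⋂L {P}) , (λ ⋂L → ⋂L K (resize refl))
    where
    L : Pred (Pred X 0ℓ) 0ℓ
    L U = Resize (U ≡ K)
    L-compactOpen : ∀ U → L U → IsCompactOpen U
    L-compactOpen U LU with unresize LU
    ... | refl = K-compactOpen
    L-directed : ∀ U V → L U → L V → ∃ λ W → L W × W ⊆ (U ∩ V)
    L-directed U V LU LV with unresize LU | unresize LV
    ... | refl | refl = U , LU , λ KP → KP , KP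
    K⊆⋂L : ∀ {P} → K P → ∀ U → L U → U P
    K⊆⋂L KP U LU with unresize LU
    ... | refl = KP

  I-∁β⇒≤ : ∀ {a b} → I-of (∁ (βset a)) b → b ≤ a
  I-∁β⇒≤ Ib = βset-⊆⇒≤ (λ {Q} Qb → ¬¬-elim (λ ¬Qa → Ib Q ¬Qa Qb))

  R-∁β : ∀ {P a} → ¬ P ∋ m a → R P (∁ (βset a))
  R-∁β {P} {a} ¬Pma b Pmb Ib = ¬Pma (IsFilter.upset (isFilter P) (m-mono b a (I-∁β⇒≤ Ib)) Pmb)

  β-m : ∀ a → β (m a) ≈ᵤ mᵤ mR-preservesUp (β a)
  β-m a = (λ {P} → m∈⇒mR {P}) , (λ {P} → mR⇒m∈ {P})
    where
    m∈⇒mR : ∀ {P} → Lift ℓU (P ∋ m a) → mR (proj₁ (β a)) P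
    m∈⇒mR (lift Pma) Z _ RPZ = ¬¬-elim λ Z∩βa≡∅ → RPZ a Pma (λ Q ZQ Qa → Z∩βa≡∅ (Q , ZQ , lift Qa))
    mR⇒m∈ : ∀ {P} → mR (proj₁ (β a)) P → Lift ℓU (P ∋ m a)
    mR⇒m∈ {P} mRβaP = lift (¬¬-elim λ ¬Pma →
      let ∁βa∈𝒮 = compactOpen⇒InS (∁β-isOpen a , ∁β-isCompact a)
          (Q , ¬Qa , lift Qa) = mRβaP (∁ (βset a)) ∁βa∈𝒮 (R-∁β {P} ¬Pma)
      in ¬Qa Qa)

mainTheorem1 : LEM → Zorn → (𝔸 : MonotonicDistributiveSemilattice) →
    let open MonotonicDistributiveSemilattice 𝔸 in
    let open Dual 𝔸 in
    Σ[ cl ∈ (∀ U → IsUp U → IsUp (mR U)) ]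
      ( IsMonotonicDistributiveSemilattice _≈ᵤ_ _∩ᵤ_ Xᵤ (mᵤ cl)
      × MonoidMorphisms.IsMonoidMonomorphism rawMonoid rawMonoidUp β
      × (∀ a → β (m a) ≈ᵤ mᵤ cl (β a)) )
mainTheorem1 lem zorn 𝔸 =
  mR-preservesUp , Up-isMonotonicDistributiveSemilattice , β-isMonoidMonomorphism , β-m
  where
  open Upsets 𝔸
  open Representation lem zorn 𝔸
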